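{- For every generalised clause-set $F$, the lean kernel of $F$ equals the set $U(F)$ of clauses of $F$ which are used (as a leaf label) in some tree resolution refutation of $F$. Consequently $F$ is lean if and only if every clause of $F$ is used in some tree resolution refutation of $F$.
   Context: Each variable $v$ has a finite non-empty domain $D_v$; a literal is a pair $(v,\varepsilon)$, $\varepsilon\in D_v$, meaning "$v\ne\varepsilon$"; a clause is a finite set of literals with no two distinct literals on the same variable; a clause-set is a finite set of clauses. A partial assignment $\varphi$ maps a finite set $\mathrm{var}(\varphi)$ of variables to values in their domains and satisfies $(v,\varepsilon)$ iff $v\in\mathrm{var}(\varphi)$ and $\varphi(v)\ne\varepsilon$; it is an autarky for $F$ iff every clause $C\in F$ with $\mathrm{var}(C)\cap\mathrm{var}(\varphi)\ne\emptyset$ is satisfied by $\varphi$, non-trivial iff $\mathrm{var}(\varphi)\cap\mathrm{var}(F)\neq\emptyset$. $F$ is lean iff it has no non-trivial autarky; the lean kernel of $F$ is the largest lean subset of $F$. Resolution: clauses $C_1,\dots,C_{|D_v|}$ are resolvable on variable $v$ if every value $\varepsilon\in D_v$ occurs in some literal $(v,\varepsilon)\in C_i$ and $R:=\bigcup_i\{x\in C_i:\mathrm{var}(x)\ne v\}$ is a clause (contains no two distinct literals on the same variable); $R$ is the resolvent. A tree resolution refutation of $F$ is a finite rooted tree whose leaves are labelled by clauses of $F$, each inner node labelled by a resolvent of the labels of its children, and the root labelled by the empty clause. -}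

module Defs where

open import Data.Nat using (ℕ; suc; _≤_)
open import Data.Fin using (Fin)
open import Data.Maybe using (Maybe; just; nothing)
open import Data.Product using (Σ; Σ-syntax; ∃; ∃-syntax; _×_; _,_; proj₁)
open import Data.List using (List; [])
open import Data.List.Membership.Propositional using (_∈_)
open import Data.List.Relation.Binary.Subset.Propositional using (_⊆_)
open import Function.Bundles using (_⇔_)
open import Relation.Binary.PropositionalEquality using (_≡_; _≢_)
open import Relation.Nullary using (¬_)

-- Variables are natural numbers.  A domain-size function d : ℕ → ℕ fixes
-- the (finite, non-empty) domain of variable v as D_v = Fin (suc (d v)).
module _ (d : ℕ → ℕ) where

  Val : ℕ → Set
  Val v = Fin (suc (d v))

  -- literal (v , ε) means "v ≠ ε"
  Lit : Set
  Lit = Σ ℕ Val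

  var : Lit → ℕ
  var = proj₁

  -- a clause is represented by a list of literals (read as a finite set,
  -- via membership); the side condition "no two distinct literals on the
  -- same variable" is ClashFree.
  Clause : Set
  Clause = List Lit

  ClashFree : Clause → Set
  ClashFree C = ∀ {x y} → x ∈ C → y ∈ C → var x ≡ var y → x ≡ y

  ClauseList : Set
  ClauseList = List Clause

  IsClauseSet : ClauseList → Set
  IsClauseSet F = ∀ {C} → C ∈ F → ClashFree C

  PAss : Set
  PAss = (v : ℕ) → Maybe (Val v)

  FiniteDom : PAss → Set
  FiniteDom φ = ∃[ n ] (∀ v → n ≤ v → φ v ≡ nothing)

  InDom : PAss → ℕ → Set
  InDom φ v = ∃[ δ ] (φ v ≡ just δ)

  SatLit : PAss → Lit → Set
  SatLit φ (v , ε) = Σ[ δ ∈ Val v ] (φ v ≡ just δ × δ ≢ ε)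

  SatClause : PAss → Clause → Set
  SatClause φ C = ∃[ x ] (x ∈ C × SatLit φ x)

  Touches : PAss → Clause → Set
  Touches φ C = ∃[ x ] (x ∈ C × InDom φ (var x))

  IsAutarky : PAss → ClauseList → Set
  IsAutarky φ F = ∀ C → C ∈ F → Touches φ C → SatClause φ C

  NonTrivial : PAss → ClauseList → Set
  NonTrivial φ F = ∃[ C ] (C ∈ F × Touches φ C)

  Lean : ClauseList → Set
  Lean F = ∀ (φ : PAss) → FiniteDom φ → IsAutarky φ F → ¬ NonTrivial φ F

  IsLeanKernel : ClauseList → ClauseList → Set
  IsLeanKernel F K = K ⊆ F × Lean K × (∀ G → G ⊆ F → Lean G → G ⊆ K)

  -- An inner node resolves on v the children C_ε (one child for each of the
  -- |D_v| positions, indexed by Fin (suc (d v))), every value ε ∈ D_v occurs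
  -- in some literal (v , ε) of some child, and the label R is the resolvent:
  -- (as a set) the union of the children minus literals on v, and a clause.
  data Deriv (F : ClauseList) : Clause → Set where
    leaf : ∀ {C} → C ∈ F → Deriv F C
    node : ∀ {R} (v : ℕ) (Cs : Val v → Clause)
           → (∀ (ε : Val v) → ∃[ i ] ((v , ε) ∈ Cs i))
           → (∀ x → x ∈ R ⇔ (∃[ i ] (x ∈ Cs i × var x ≢ v)))
           → ClashFree R
           → ((i : Val v) → Deriv F (Cs i))
           → Deriv F R

  UsesLeaf : ∀ {F R} → Deriv F R → Clause → Set
  UsesLeaf (leaf {C} _) D = C ≡ D
  UsesLeaf (node v Cs _ _ _ ts) D = ∃[ i ] UsesLeaf (ts i) D

  Refutation : ClauseList → Set
  Refutation F = Deriv F []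

  Used : ClauseList → Clause → Set
  Used F C = Σ[ t ∈ Refutation F ] UsesLeaf t C

-- An autarky that touches a leaf of a tree resolution derivation satisfies every clause on the
-- path to the root: if the literal satisfying a child is on the resolved variable v, the child
-- containing the literal v ≠ φ(v) is touched as well, and by clash-freeness it is satisfied off v.
-- Hence no autarky touches a clause used in a refutation.
--
-- Conversely, fix C ∈ F and run a semantic-tree search over the variables of F.  At a variable v
-- unassigned by ρ, search below every extension ρ ∪ {v ↦ δ}.  Unless one of them finds an autarky
-- touching C, each yields a derived clause falsified by ρ ∪ {v ↦ δ}; either one of them is
-- already falsified by ρ, or together they say that ρ excludes every value of v ("v is blocked").
-- When every variable is assigned or blocked, either ρ is an autarky touching C, or a clause of F
-- that ρ touches without satisfying, or else C itself, can be resolved against the blocks into a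
-- clause falsified by ρ.  At the empty assignment that clause is empty, so it is a refutation,
-- and one using C.
-- The lean kernel is therefore the set of used clauses, which this dichotomy makes decidable.
module Submission where

open import Defs
open import Data.Nat using (ℕ; suc; _⊔_)
open import Data.Nat.Properties using (_≟_; ≤-trans; m≤m⊔n; m≤n⊔m; 1+n≰n)
import Data.Fin.Properties as Fin
open import Data.Maybe using (Maybe; just; nothing)
open import Data.Maybe.Properties using (just-injective)
open import Data.Product using (Σ-syntax; ∃-syntax; _×_; _,_; proj₁; proj₂)
open import Data.Product.Properties using () renaming (≡-dec to Σ-≡-dec)
open import Data.Sum using (_⊎_; inj₁; inj₂; map₁)
open import Data.Empty using (⊥-elim)
open import Data.List using (List; []; _∷_; map; concatMap; filter; allFin)
import Data.List.Properties as List
open import Data.List.Relation.Unary.Any using (here; there) renaming (tail to Any-tail)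
open import Data.List.Membership.Propositional using (_∈_; lose; find)
import Data.List.Membership.DecPropositional as DecMembership
open import Data.List.Membership.Propositional.Properties
  using (∈-map⁺; ∈-concatMap⁺; ∈-concatMap⁻; ∈-allFin; ∈-filter⁺; ∈-filter⁻)
open import Data.List.Relation.Binary.Subset.Propositional using (_⊆_)
open import Function using (id; _∘_)
open import Function.Bundles using (_⇔_; mk⇔; Equivalence)
open import Relation.Binary.Definitions using (DecidableEquality)
open import Relation.Binary.PropositionalEquality using (_≡_; _≢_; refl; sym; trans)
open import Relation.Nullary using (¬_; yes; no; ¬?)
open import Relation.Unary using (Decidable)

some-or-all : ∀ {A : Set} {P Q : A → Set} (xs : List A) → (∀ x → x ∈ xs → P x ⊎ Q x)
            → (∃[ x ] (x ∈ xs × P x)) ⊎ (∀ x → x ∈ xs → Q x)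
some-or-all [] pq = inj₂ (λ _ ())
some-or-all (y ∷ xs) pq with pq y (here refl) | some-or-all xs (λ x → pq x ∘ there)
... | inj₁ py | _                  = inj₁ (y , here refl , py)
... | inj₂ _  | inj₁ (x , x∈ , px) = inj₁ (x , there x∈ , px)
... | inj₂ qy | inj₂ qxs           = inj₂ λ { _ (here refl) → qy ; x (there x∈) → qxs x x∈ }

module Resolution (d : ℕ → ℕ) where

  Falsifies : PAss d → Lit d → Set
  Falsifies ρ (v , ε) = ρ v ≡ just ε

  FalsifiedBy : PAss d → Clause d → Set
  FalsifiedBy ρ P = ∀ {x} → x ∈ P → Falsifies ρ x

  Unsat : PAss d → Lit d → Set
  Unsat ρ x = Falsifies ρ x ⊎ ρ (var d x) ≡ nothing

  unassigned≢assigned : ∀ {A : Set} {m : Maybe A} {a} → m ≡ nothing → m ≢ just a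
  unassigned≢assigned m≡nothing m≡a with () ← trans (sym m≡nothing) m≡a

  falsified⇒¬satisfied : ∀ {ρ x} → Falsifies ρ x → ¬ SatLit d ρ x
  falsified⇒¬satisfied ρv≡ε (δ , ρv≡δ , δ≢ε) = δ≢ε (just-injective (trans (sym ρv≡δ) ρv≡ε))

  falsified-on-same-var : ∀ {ρ x y} → Falsifies ρ x → Falsifies ρ y → var d x ≡ var d y → x ≡ y
  falsified-on-same-var ρv≡ε ρv≡ε' refl with refl ← trans (sym ρv≡ε) ρv≡ε' = refl

  unsat-beside-falsified : ∀ {ρ x y} → Unsat ρ x → Falsifies ρ y → var d x ≡ var d y → Falsifies ρ x
  unsat-beside-falsified (inj₁ ρx) _ _ = ρx
  unsat-beside-falsified (inj₂ free) ρy refl = ⊥-elim (unassigned≢assigned free ρy)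

  sat⊎unsat : ∀ ρ x → SatLit d ρ x ⊎ Unsat ρ x
  sat⊎unsat ρ (v , ε) with ρ v in ρv
  ... | nothing = inj₂ (inj₂ refl)
  ... | just δ with δ Fin.≟ ε
  ...   | yes refl = inj₂ (inj₁ refl)
  ...   | no δ≢ε = inj₁ (δ , refl , δ≢ε)

  on-var? : ∀ v x → var d x ≡ v ⊎ var d x ≢ v
  on-var? v x with var d x ≟ v
  ... | yes x≡v = inj₁ x≡v
  ... | no x≢v = inj₂ x≢v

  derived-clashFree : ∀ {G R} → IsClauseSet d G → Deriv d G R → ClashFree d R
  derived-clashFree cs (leaf C∈G) = cs C∈G
  derived-clashFree cs (node _ _ _ _ cf _) = cf

  resolvent-satisfied : ∀ {φ R v} {Cs : Val d v → Clause d}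
    → (∀ ε → ∃[ i ] ((v , ε) ∈ Cs i))
    → (∀ x → x ∈ R ⇔ (∃[ i ] (x ∈ Cs i × var d x ≢ v)))
    → (∀ i → ClashFree d (Cs i))
    → (∀ i → Touches d φ (Cs i) → SatClause d φ (Cs i))
    → ∃[ i ] SatClause d φ (Cs i) → SatClause d φ R
  resolvent-satisfied {φ} {v = v} cov mem cf sat (i , (w , ε) , x∈Ci , φx) with w ≟ v
  ... | no w≢v = (w , ε) , Equivalence.from (mem _) (i , x∈Ci , w≢v) , φx
  ... | yes refl with φx
  ...   | δ , φv≡δ , _ with cov δ
  ...     | j , vδ∈Cj with sat j ((v , δ) , vδ∈Cj , δ , φv≡δ)
  ...       | (w′ , ε′) , y∈Cj , φy with w′ ≟ v
  ...         | no w′≢v = (w′ , ε′) , Equivalence.from (mem _) (j , y∈Cj , w′≢v) , φy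
  ...         | yes refl with refl ← cf j vδ∈Cj y∈Cj refl = ⊥-elim (falsified⇒¬satisfied {φ} φv≡δ φy)

  autarky-satisfies-touched : ∀ {G R φ} → IsClauseSet d G → IsAutarky d φ G
    → Deriv d G R → Touches d φ R → SatClause d φ R
  autarky-satisfies-touched cs aut (leaf C∈G) = aut _ C∈G
  autarky-satisfies-touched cs aut (node v Cs cov mem cf ts) (x , x∈R , x-assigned)
    with Equivalence.to (mem x) x∈R
  ... | i , x∈Ci , _ =
    resolvent-satisfied cov mem (derived-clashFree cs ∘ ts) (autarky-satisfies-touched cs aut ∘ ts)
      (i , autarky-satisfies-touched cs aut (ts i) (x , x∈Ci , x-assigned))

  autarky-satisfies-below-touched-leaf : ∀ {G R D φ} → IsClauseSet d G → IsAutarky d φ G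
    → (t : Deriv d G R) → UsesLeaf d t D → Touches d φ D → SatClause d φ R
  autarky-satisfies-below-touched-leaf cs aut (leaf C∈G) refl = aut _ C∈G
  autarky-satisfies-below-touched-leaf cs aut (node v Cs cov mem cf ts) (i , used) touches =
    resolvent-satisfied cov mem (derived-clashFree cs ∘ ts) (autarky-satisfies-touched cs aut ∘ ts)
      (i , autarky-satisfies-below-touched-leaf cs aut (ts i) used touches)

  used⇒untouched : ∀ {G C φ} → IsClauseSet d G → IsAutarky d φ G → Used d G C → ¬ Touches d φ C
  used⇒untouched cs aut (t , used) touches
    with _ , () , _ ← autarky-satisfies-below-touched-leaf cs aut t used touches

  leaf∈ : ∀ {G R D} (t : Deriv d G R) → UsesLeaf d t D → D ∈ G
  leaf∈ (leaf C∈G) refl = C∈G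
  leaf∈ (node _ _ _ _ _ ts) (i , used) = leaf∈ (ts i) used

  rebase : ∀ {G H R} (t : Deriv d G R) → (∀ D → UsesLeaf d t D → D ∈ H)
         → Σ[ t′ ∈ Deriv d H R ] (∀ D → UsesLeaf d t D → UsesLeaf d t′ D)
  rebase (leaf {C} _) leaves = leaf (leaves C refl) , λ _ used → used
  rebase {H = H} (node v Cs cov mem cf ts) leaves =
    node v Cs cov mem cf (λ i → proj₁ (rebased i)) , λ { D (i , used) → i , proj₂ (rebased i) D used }
    where
      rebased : ∀ i → Σ[ t′ ∈ Deriv d H (Cs i) ] (∀ D → UsesLeaf d (ts i) D → UsesLeaf d t′ D)
      rebased i = rebase (ts i) (λ D used → leaves D (i , used))

  resolvent : (v : ℕ) → (Val d v → Clause d) → Clause d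
  resolvent v Cs = filter (λ x → ¬? (var d x ≟ v)) (concatMap Cs (allFin _))

  ∈-resolvent : ∀ v Cs x → x ∈ resolvent v Cs ⇔ (∃[ i ] (x ∈ Cs i × var d x ≢ v))
  ∈-resolvent v Cs x = mk⇔ to from
    where
      to : x ∈ resolvent v Cs → ∃[ i ] (x ∈ Cs i × var d x ≢ v)
      to x∈R with x∈⋃ , x≢v ← ∈-filter⁻ (λ y → ¬? (var d y ≟ v)) {xs = concatMap Cs (allFin _)} x∈R
             with i , _ , x∈Ci ← find (∈-concatMap⁻ Cs {xs = allFin _} x∈⋃) = i , x∈Ci , x≢v
      from : ∃[ i ] (x ∈ Cs i × var d x ≢ v) → x ∈ resolvent v Cs
      from (i , x∈Ci , x≢v) = ∈-filter⁺ (λ y → ¬? (var d y ≟ v)) (∈-concatMap⁺ Cs (lose (∈-allFin i) x∈Ci)) x≢v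

  vars : ClauseList d → List ℕ
  vars = concatMap (map (var d))

  ∈-vars : ∀ {G E x} → E ∈ G → x ∈ E → var d x ∈ vars G
  ∈-vars E∈G x∈E = ∈-concatMap⁺ (map (var d)) (lose E∈G (∈-map⁺ (var d) x∈E))

  assign : PAss d → (v : ℕ) → Val d v → PAss d
  assign ρ v δ w with w ≟ v
  ... | yes refl = just δ
  ... | no _ = ρ w

  assign-same : ∀ ρ v δ → assign ρ v δ v ≡ just δ
  assign-same ρ v δ with v ≟ v
  ... | yes refl = refl
  ... | no v≢v = ⊥-elim (v≢v refl)

  assign-other : ∀ ρ v δ {w} → w ≢ v → assign ρ v δ w ≡ ρ w
  assign-other ρ v δ {w} w≢v with w ≟ v
  ... | yes refl = ⊥-elim (w≢v refl)
  ... | no _ = refl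

  assign-finite : ∀ {ρ} v δ → FiniteDom d ρ → FiniteDom d (assign ρ v δ)
  assign-finite {ρ} v δ (n , beyond) = n ⊔ suc v , λ w n⊔v≤w →
    trans (assign-other ρ v δ (λ { refl → 1+n≰n (≤-trans (m≤n⊔m n (suc v)) n⊔v≤w) }))
          (beyond w (≤-trans (m≤m⊔n n (suc v)) n⊔v≤w))

  _⊑_ : PAss d → PAss d → Set
  ρ ⊑ ρ′ = ∀ {w a} → ρ w ≡ just a → ρ′ w ≡ just a

  ⊑-assign : ∀ {ρ v} δ → ρ v ≡ nothing → ρ ⊑ assign ρ v δ
  ⊑-assign {ρ} {v} δ ρv≡nothing {w} ρw≡a with w ≟ v
  ... | yes refl = ⊥-elim (unassigned≢assigned ρv≡nothing ρw≡a)
  ... | no _ = ρw≡a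

  _≟-lit_ : DecidableEquality (Lit d)
  _≟-lit_ = Σ-≡-dec _≟_ Fin._≟_

  _≟-clause_ : DecidableEquality (Clause d)
  _≟-clause_ = List.≡-dec _≟-lit_

module Completeness (d : ℕ → ℕ) (F : ClauseList d) (F-clauses : IsClauseSet d F) where
  open Resolution d

  AutarkyTouching : Clause d → Set
  AutarkyTouching C = ∃[ φ ] (FiniteDom d φ × IsAutarky d φ F × Touches d φ C)

  -- A derivation of a clause which, under ρ, reduces to the unit clause u ≠ c.
  record Excludes (ρ : PAss d) (u : ℕ) (c : Val d u) : Set where
    field
      {clause}       : Clause d
      deriv          : Deriv d F clause
      contains       : (u , c) ∈ clause
      rest-falsified : ∀ {x} → x ∈ clause → var d x ≢ u → Falsifies ρ x

  Blocked : PAss d → ℕ → Set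
  Blocked ρ u = ∀ c → Excludes ρ u c

  Blocked-⊑ : ∀ {ρ ρ′ u} → ρ ⊑ ρ′ → Blocked ρ u → Blocked ρ′ u
  Blocked-⊑ ρ⊑ρ′ blocked c = record
    { deriv = deriv ; contains = contains ; rest-falsified = λ x∈ x≢u → ρ⊑ρ′ (rest-falsified x∈ x≢u) }
    where open Excludes (blocked c)

  FreeVarsBlocked : PAss d → List ℕ → Clause d → Set
  FreeVarsBlocked ρ pending E =
    ∀ {x} → x ∈ E → ρ (var d x) ≡ nothing → var d x ∈ pending × Blocked ρ (var d x)

  -- Resolving E on an unassigned variable u against the clauses excluding the other values of u.
  module Eliminate {ρ u E} (t : Deriv d F E) (a : Val d u) (ua∈E : (u , a) ∈ E) (blocked : Blocked ρ u)
                   (E-clashFree : ClashFree d E) (E-unsat : ∀ {x} → x ∈ E → Unsat ρ x) where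

    Cs : Val d u → Clause d
    Cs c with c Fin.≟ a
    ... | yes _ = E
    ... | no _ = Excludes.clause (blocked c)

    children : ∀ c → Deriv d F (Cs c)
    children c with c Fin.≟ a
    ... | yes _ = t
    ... | no _ = Excludes.deriv (blocked c)

    covers : ∀ c → (u , c) ∈ Cs c
    covers c with c Fin.≟ a
    ... | yes refl = ua∈E
    ... | no _ = Excludes.contains (blocked c)

    child-lit : ∀ c {z} → z ∈ Cs c → var d z ≢ u → z ∈ E ⊎ Falsifies ρ z
    child-lit c with c Fin.≟ a
    ... | yes _ = λ z∈E _ → inj₁ z∈E
    ... | no _ = λ z∈ z≢u → inj₂ (Excludes.rest-falsified (blocked c) z∈ z≢u)

    E⊆Ca : ∀ {z} → z ∈ E → z ∈ Cs a
    E⊆Ca with a Fin.≟ a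
    ... | yes _ = id
    ... | no a≢a = ⊥-elim (a≢a refl)

    leaves-of-a : ∀ D → UsesLeaf d t D → UsesLeaf d (children a) D
    leaves-of-a with a Fin.≟ a
    ... | yes _ = λ _ used → used
    ... | no a≢a = ⊥-elim (a≢a refl)

    R : Clause d
    R = resolvent u Cs

    R-lit : ∀ {z} → z ∈ R → (z ∈ E × var d z ≢ u) ⊎ Falsifies ρ z
    R-lit {z} z∈R with c , z∈Cc , z≢u ← Equivalence.to (∈-resolvent u Cs z) z∈R
      = map₁ (_, z≢u) (child-lit c z∈Cc z≢u)

    E⊆R : ∀ {z} → z ∈ E → var d z ≢ u → z ∈ R
    E⊆R z∈E z≢u = Equivalence.from (∈-resolvent u Cs _) (a , E⊆Ca z∈E , z≢u)

    R-unsat : ∀ {z} → z ∈ R → Unsat ρ z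
    R-unsat z∈R with R-lit z∈R
    ... | inj₁ (z∈E , _) = E-unsat z∈E
    ... | inj₂ ρz = inj₁ ρz

    R-clashFree : ClashFree d R
    R-clashFree z∈R y∈R same with R-lit z∈R | R-lit y∈R
    ... | inj₁ (z∈E , _) | inj₁ (y∈E , _) = E-clashFree z∈E y∈E same
    ... | inj₂ ρz | inj₂ ρy = falsified-on-same-var ρz ρy same
    ... | inj₁ (z∈E , _) | inj₂ ρy =
      falsified-on-same-var (unsat-beside-falsified (E-unsat z∈E) ρy same) ρy same
    ... | inj₂ ρz | inj₁ (y∈E , _) =
      falsified-on-same-var ρz (unsat-beside-falsified (E-unsat y∈E) ρz (sym same)) same

    R-deriv : Deriv d F R
    R-deriv = node u Cs (λ c → c , covers c) (∈-resolvent u Cs) R-clashFree children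

    R-leaves : ∀ D → UsesLeaf d t D → UsesLeaf d R-deriv D
    R-leaves D used = a , leaves-of-a D used

  record Falsification (ρ : PAss d) {E : Clause d} (t : Deriv d F E) : Set where
    field
      {clause}        : Clause d
      deriv           : Deriv d F clause
      falsified       : FalsifiedBy ρ clause
      keeps-falsified : ∀ {x} → x ∈ E → Falsifies ρ x → x ∈ clause
      keeps-leaves    : ∀ D → UsesLeaf d t D → UsesLeaf d deriv D

  FreeVarsBlocked-tail : ∀ {ρ u pending E} → (∀ {x} → x ∈ E → ρ (var d x) ≡ nothing → var d x ≢ u)
    → FreeVarsBlocked ρ (u ∷ pending) E → FreeVarsBlocked ρ pending E
  FreeVarsBlocked-tail off-u free x∈E free-x =
    Any-tail (off-u x∈E free-x) (proj₁ (free x∈E free-x)) , proj₂ (free x∈E free-x)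

  falsify : ∀ ρ pending {E} (t : Deriv d F E) → ClashFree d E → (∀ {x} → x ∈ E → Unsat ρ x)
          → FreeVarsBlocked ρ pending E → Falsification ρ t
  falsify ρ [] {E} t cf unsat free = record
    { deriv = t ; falsified = falsified ; keeps-falsified = λ x∈E _ → x∈E ; keeps-leaves = λ _ used → used }
    where
      falsified : FalsifiedBy ρ E
      falsified x∈E with unsat x∈E
      ... | inj₁ ρx = ρx
      ... | inj₂ free-x with () ← proj₁ (free x∈E free-x)
  falsify ρ (u ∷ pending) {E} t cf unsat free with ρ u in ρu | some-or-all E (λ x _ → on-var? u x)
  ... | just b | _ = falsify ρ pending t cf unsat
    (FreeVarsBlocked-tail (λ { _ free-x refl → unassigned≢assigned free-x ρu }) free)
  ... | nothing | inj₂ off-u = falsify ρ pending t cf unsat (FreeVarsBlocked-tail (λ x∈E _ → off-u _ x∈E) free)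
  ... | nothing | inj₁ ((u , a) , ua∈E , refl) = record
    { deriv = deriv ; falsified = falsified
    ; keeps-falsified = λ x∈E ρx → keeps-falsified (E⊆R x∈E (λ { refl → unassigned≢assigned ρu ρx })) ρx
    ; keeps-leaves = λ D → keeps-leaves D ∘ R-leaves D }
    where
      open Eliminate t a ua∈E (proj₂ (free ua∈E ρu)) cf unsat
      R-free : FreeVarsBlocked ρ pending R
      R-free z∈R free-z with R-lit z∈R
      ... | inj₁ (z∈E , z≢u) = Any-tail z≢u (proj₁ (free z∈E free-z)) , proj₂ (free z∈E free-z)
      ... | inj₂ ρz = ⊥-elim (unassigned≢assigned free-z ρz)
      open Falsification (falsify ρ pending R-deriv R-clashFree R-unsat R-free)

  Settled : PAss d → ℕ → Set
  Settled ρ w = InDom d ρ w ⊎ Blocked ρ w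

  SettledExcept : PAss d → List ℕ → Set
  SettledExcept ρ pending = ∀ w → w ∈ vars F → w ∈ pending ⊎ Settled ρ w

  SettledExcept-⊑ : ∀ {ρ ρ′ pending} → ρ ⊑ ρ′ → SettledExcept ρ pending → SettledExcept ρ′ pending
  SettledExcept-⊑ ρ⊑ρ′ settled w w∈ with settled w w∈
  ... | inj₁ pending = inj₁ pending
  ... | inj₂ (inj₁ (a , ρw)) = inj₂ (inj₁ (a , ρ⊑ρ′ ρw))
  ... | inj₂ (inj₂ blocked) = inj₂ (inj₂ (Blocked-⊑ ρ⊑ρ′ blocked))

  settle : ∀ {ρ v pending} → Settled ρ v → SettledExcept ρ (v ∷ pending) → SettledExcept ρ pending
  settle s settled w w∈ with settled w w∈
  ... | inj₁ (here refl) = inj₂ s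
  ... | inj₁ (there w∈pending) = inj₁ w∈pending
  ... | inj₂ s′ = inj₂ s′

  module Search (C : Clause d) (C∈F : C ∈ F) where

    -- The first disjunct lets a conflict found deep in the search be passed up without C;
    -- at the empty assignment the clause is necessarily empty, so only the second survives.
    record Conflict (ρ : PAss d) : Set where
      field
        {clause}           : Clause d
        deriv              : Deriv d F clause
        falsified          : FalsifiedBy ρ clause
        nonempty-or-uses-C : (∃[ x ] x ∈ clause) ⊎ UsesLeaf d deriv C

    module AllSettled (ρ : PAss d) (settled : ∀ w → w ∈ vars F → Settled ρ w) where

      falsify-clause : ∀ {E} (E∈F : E ∈ F) → (∀ {x} → x ∈ E → Unsat ρ x) → Falsification ρ (leaf E∈F)
      falsify-clause E∈F unsat = falsify ρ (vars F) (leaf E∈F) (F-clauses E∈F) unsat λ x∈E free-x →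
        ∈-vars E∈F x∈E , blocked (settled _ (∈-vars E∈F x∈E)) free-x
        where
          blocked : ∀ {w} → Settled ρ w → ρ w ≡ nothing → Blocked ρ w
          blocked (inj₁ (_ , ρw)) free-w = ⊥-elim (unassigned≢assigned free-w ρw)
          blocked (inj₂ b) _ = b

      clause-status : ∀ E → E ∈ F → Conflict ρ ⊎ (SatClause d ρ E ⊎ ¬ Touches d ρ E)
      clause-status E E∈F with some-or-all E (λ x _ → sat⊎unsat ρ x)
      ... | inj₁ satisfied = inj₂ (inj₁ satisfied)
      ... | inj₂ unsat with some-or-all E (λ x x∈E → unsat x x∈E)
      ...   | inj₁ (x , x∈E , ρx) = inj₁ record
        { deriv = deriv ; falsified = falsified ; nonempty-or-uses-C = inj₁ (x , keeps-falsified x∈E ρx) }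
        where open Falsification (falsify-clause E∈F (unsat _))
      ...   | inj₂ free = inj₂ (inj₂ λ (x , x∈E , _ , ρx) → unassigned≢assigned (free x x∈E) ρx)

      autarky-or-conflict : FiniteDom d ρ → AutarkyTouching C ⊎ Conflict ρ
      autarky-or-conflict finite with some-or-all F clause-status
      ... | inj₁ (_ , _ , conflict) = inj₂ conflict
      ... | inj₂ statuses with some-or-all C (λ x _ → sat⊎unsat ρ x)
      ...   | inj₁ (x , x∈C , δ , ρx , _) = inj₁ (ρ , finite , autarky , x , x∈C , δ , ρx)
        where
          autarky : IsAutarky d ρ F
          autarky E E∈F touches with statuses E E∈F
          ... | inj₁ satisfied = satisfied
          ... | inj₂ untouched = ⊥-elim (untouched touches)
      ...   | inj₂ unsat = inj₂ record
        { deriv = deriv ; falsified = falsified ; nonempty-or-uses-C = inj₂ (keeps-leaves C refl) }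
        where open Falsification (falsify-clause C∈F (unsat _))

    conflict-after-assign : ∀ ρ v δ → Conflict (assign ρ v δ) → Conflict ρ ⊎ Excludes ρ v δ
    conflict-after-assign ρ v δ conflict with some-or-all (Conflict.clause conflict) (λ x _ → on-var? v x)
    ... | inj₂ off-v = inj₁ record
      { deriv = deriv ; nonempty-or-uses-C = nonempty-or-uses-C
      ; falsified = λ {x} x∈ → trans (sym (assign-other ρ v δ (off-v x x∈))) (falsified x∈) }
      where open Conflict conflict
    ... | inj₁ ((v , ε) , vε∈ , refl)
      with refl ← trans (sym (assign-same ρ v δ)) (Conflict.falsified conflict vε∈) = inj₂ record
      { deriv = deriv ; contains = vε∈
      ; rest-falsified = λ x∈ x≢v → trans (sym (assign-other ρ v δ x≢v)) (falsified x∈) }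
      where open Conflict conflict

    search : ∀ pending ρ → FiniteDom d ρ → SettledExcept ρ pending → AutarkyTouching C ⊎ Conflict ρ
    search [] ρ finite settled = AllSettled.autarky-or-conflict ρ all-settled finite
      where
        all-settled : ∀ w → w ∈ vars F → Settled ρ w
        all-settled w w∈ with settled w w∈
        ... | inj₂ s = s
    search (v ∷ pending) ρ finite settled with ρ v in ρv
    ... | just a = search pending ρ finite (settle (inj₁ (a , ρv)) settled)
    ... | nothing with some-or-all (allFin _) (λ δ _ →
                         search pending (assign ρ v δ) (assign-finite v δ finite)
                           (settle (inj₁ (δ , assign-same ρ v δ)) (SettledExcept-⊑ (⊑-assign δ ρv) settled)))
    ...   | inj₁ (_ , _ , found) = inj₁ found
    ...   | inj₂ conflicts with some-or-all (allFin _) (λ δ δ∈ → conflict-after-assign ρ v δ (conflicts δ δ∈))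
    ...     | inj₁ (_ , _ , conflict) = inj₂ conflict
    ...     | inj₂ excluded = search pending ρ finite (settle (inj₂ λ δ → excluded δ (∈-allFin δ)) settled)

    autarky-or-used : AutarkyTouching C ⊎ Used d F C
    autarky-or-used with search (vars F) (λ _ → nothing) (0 , λ _ _ → refl) (λ _ → inj₁)
    ... | inj₁ found = inj₁ found
    ... | inj₂ record { clause = [] ; deriv = t ; nonempty-or-uses-C = inj₂ used } = inj₂ (t , used)
    ... | inj₂ record { clause = [] ; nonempty-or-uses-C = inj₁ (_ , ()) }
    ... | inj₂ record { clause = _ ∷ _ ; falsified = falsified } with () ← falsified (here refl)

  open Search using (autarky-or-used) public

module LeanKernel (d : ℕ → ℕ) (F : ClauseList d) (F-clauses : IsClauseSet d F) where
  open Resolution d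
  open Completeness d F F-clauses using (autarky-or-used)
  open DecMembership _≟-clause_ using (_∈?_)

  used? : Decidable (Used d F)
  used? C with C ∈? F
  ... | no C∉F = no λ (t , used) → C∉F (leaf∈ t used)
  ... | yes C∈F with autarky-or-used C C∈F
  ...   | inj₂ used = yes used
  ...   | inj₁ (_ , _ , aut , touches) = no λ used → used⇒untouched F-clauses aut used touches

  kernel : ClauseList d
  kernel = filter used? F

  ∈-kernel : ∀ C → C ∈ kernel ⇔ (C ∈ F × Used d F C)
  ∈-kernel C = mk⇔ (∈-filter⁻ used?) (λ (C∈F , used) → ∈-filter⁺ used? C∈F used)

  kernel⊆F : kernel ⊆ F
  kernel⊆F = proj₁ ∘ ∈-filter⁻ used?

  used⇒used-in-kernel : ∀ {C} → Used d F C → Used d kernel C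
  used⇒used-in-kernel (t , used)
    with t′ , keeps ← rebase t (λ D used-D → ∈-filter⁺ used? (leaf∈ t used-D) (t , used-D)) = t′ , keeps _ used

  kernel-lean : Lean d kernel
  kernel-lean φ _ aut (C , C∈K , touches) =
    used⇒untouched (F-clauses ∘ kernel⊆F) aut
      (used⇒used-in-kernel (proj₂ (∈-filter⁻ used? {xs = F} C∈K))) touches

  kernel-maximal : ∀ G → G ⊆ F → Lean d G → G ⊆ kernel
  kernel-maximal G G⊆F G-lean {C} C∈G with autarky-or-used C (G⊆F C∈G)
  ... | inj₂ used = ∈-filter⁺ used? (G⊆F C∈G) used
  ... | inj₁ (φ , finite , aut , touches) =
    ⊥-elim (G-lean φ finite (λ E E∈G → aut E (G⊆F E∈G)) (C , C∈G , touches))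

  lean⇔all-used : Lean d F ⇔ (∀ C → C ∈ F → Used d F C)
  lean⇔all-used = mk⇔
    (λ lean C C∈F → proj₂ (∈-filter⁻ used? {xs = F} (kernel-maximal F id lean C∈F)))
    (λ all-used φ _ aut (C , C∈F , touches) → used⇒untouched F-clauses aut (all-used C C∈F) touches)

theorem1p5p1 : (d : ℕ → ℕ) (F : ClauseList d) → IsClauseSet d F
    → (Σ[ K ∈ ClauseList d ] (IsLeanKernel d F K × (∀ C → (C ∈ K) ⇔ (C ∈ F × Used d F C))))
      × (Lean d F ⇔ (∀ C → C ∈ F → Used d F C))
theorem1p5p1 d F F-clauses = (kernel , (kernel⊆F , kernel-lean , kernel-maximal) , ∈-kernel) , lean⇔all-used
  where open LeanKernel d F F-clauses
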